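{- For each odd integer $m \geqslant 7$, the complete graph $K_m$ admits a decomposition into $\frac{m-5}{2}$ copies of the cycle $C_m$ and one copy of $\mathrm{Circ}(m,\{1,2\})$.
   Context: A decomposition of a graph is a set of pairwise edge-disjoint subgraphs whose edge sets together cover all edges. $C_m$ is the (undirected) cycle of length $m$. For $S\subseteq\{1,\dots,\lfloor m/2\rfloor\}$, $\mathrm{Circ}(m,S)$ is the graph with vertex set $\mathbb{Z}_m$ and edge set $\{\{i,i+s\}: i\in\mathbb{Z}_m, s\in S\}$ (addition modulo $m$). -}

module Defs where

open import Data.Nat using (ℕ; zero; suc; _+_; _%_; NonZero)
open import Data.Fin using (Fin; toℕ; zero; suc)
open import Data.List using (List; _∷_; [])
open import Data.List.Membership.Propositional using (_∈_)
open import Data.Product using (Σ; ∃; ∃-syntax; _×_; _,_)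
open import Data.Sum using (_⊎_)
open import Relation.Binary.PropositionalEquality using (_≡_)
open import Relation.Nullary using (¬_)
open import Function.Definitions using (Injective)

Graph : ℕ → Set₁
Graph n = Fin n → Fin n → Set

-- j ≡ i + s (mod m), for i, j ∈ Z_m (represented by 0..m-1) and 0 ≤ s ≤ m:
-- either j = i + s or j + m = i + s as natural numbers.
AddMod : (m : ℕ) → Fin m → ℕ → Fin m → Set
AddMod m i s j = (toℕ j ≡ toℕ i + s) ⊎ (toℕ j + m ≡ toℕ i + s)

-- Circ(m, S): vertex set Z_m (= Fin m), edge {i, i+s} for s ∈ S
-- (S ⊆ {1..⌊m/2⌋}).
Circ : (m : ℕ) → List ℕ → Graph m
Circ m S i j = Σ ℕ λ s → s ∈ S × (AddMod m i s j ⊎ AddMod m j s i)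

Cycle : (m : ℕ) → Graph m
Cycle m = Circ m (1 ∷ [])

-- The image of a graph G on Fin k under a vertex map φ : Fin k → Fin n
-- (when φ is injective this is a copy of G, as a subgraph on Fin n).
Image : {k n : ℕ} → (Fin k → Fin n) → Graph k → Graph n
Image φ G u v = ∃[ a ] ∃[ b ] (G a b × φ a ≡ u × φ b ≡ v)

IsDecompositionOfK : (n t : ℕ) → (Fin t → Graph n) → Set
IsDecompositionOfK n t H =
  (∀ i u v → H i u v → ¬ (u ≡ v)) ×
  (∀ u v → ¬ (u ≡ v) → ∃[ i ] (H i u v × (∀ j → H j u v → j ≡ i)))

Parts : (m t : ℕ) → (Fin t → Fin m → Fin m) → (Fin m → Fin m) → Fin (suc t) → Graph m
Parts m t cyc ψ zero = Image ψ (Circ m (1 ∷ 2 ∷ []))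
Parts m t cyc ψ (suc i) = Image (cyc i) (Cycle m)

module Submission where

-- Write m = 2k + 5 and n = 2k + 2, and take as vertices ℤ_n together with three hubs ∞, X and Y.
-- Walecki's zigzag paths P_j = j, j + 1, j − 1, j + 2, …, j + k + 1 (j ≤ k) are Hamiltonian paths
-- of K_n which share no edge: the edge uv lies on P_j for j = ⌊((u + v) mod n) / 2⌋.
-- For j < k, remove the first and the last edge of P_j and close it through the hubs into the
-- Hamiltonian cycle X, P_j(0), ∞, P_j(n − 1), Y, P_j(1), …, P_j(n − 2) of K_m.  The removed edges
-- are exactly the chords P_k(t) P_k(t + 2), and the hub edges these cycles miss are exactly those
-- joining vertices at distance one or two on the cycle Y, ∞, X, P_k(0), …, P_k(n − 1).  So the
-- remaining edges form the square of that cycle, a copy of Circ(m, {1, 2}).  That no edge lies in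
-- two parts follows from an explicit classifier which every part respects.

open import Defs
open import Data.Nat
open import Data.Nat.Properties
open import Data.Nat.DivMod
  using (m%n<n; m%n%n≡m%n; %-distribˡ-+; [m+n]%n≡m%n; m<n⇒m%n≡m; n%n≡0; m*n%n≡0; m*n/n≡m)
open import Data.Parity.Base as ℙ using (0ℙ; 1ℙ)
open import Data.Parity.Properties as Parity using (p+p≡0ℙ)
open import Data.Fin as Fin using (Fin; toℕ; fromℕ<)
open import Data.Fin.Properties using (toℕ-fromℕ<; toℕ-injective; toℕ<n)
open import Data.List using (_∷_; [])
open import Data.List.Membership.Propositional using (_∈_)
open import Data.List.Relation.Unary.Any using (here; there)
open import Data.Maybe using (Maybe; just; nothing; fromMaybe; _<∣>_)
open import Data.Product using (Σ; ∃₂; ∃-syntax; _×_; _,_; proj₁; proj₂)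
open import Data.Sum using (_⊎_; inj₁; inj₂; [_,_]′; swap)
open import Data.Empty using (⊥-elim)
open import Relation.Nullary using (¬_; yes; no)
open import Relation.Binary.PropositionalEquality
open import Function using (_∘_)
open import Function.Definitions using (Injective)
open import Algebra.Properties.CommutativeSemigroup +-commutativeSemigroup using (interchange)

-- Decompositions of K_m into images of circulants

decomposition-by-classifier :
  ∀ {n t} {A : Set} (H : Fin t → Graph n) (classify : Fin n → Fin n → A) (label : Fin t → A) →
  Injective _≡_ _≡_ label →
  (∀ i u v → H i u v → ¬ u ≡ v) →
  (∀ i u v → H i u v → classify u v ≡ label i) →
  (∀ u v → ¬ u ≡ v → ∃[ i ] H i u v) →
  IsDecompositionOfK n t H
decomposition-by-classifier H classify label label-injective loopless sound cover =
  loopless , λ u v u≢v → let (i , h) = cover u v u≢v in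
    i , h , λ j h′ → label-injective (trans (sym (sound j u v h′)) (sound i u v h))

image-loopless : ∀ {k n} {G : Graph k} (φ : Fin k → Fin n) → Injective _≡_ _≡_ φ →
                 (∀ a → ¬ G a a) → ∀ u v → Image φ G u v → ¬ u ≡ v
image-loopless φ φ-injective G-loopless u v (a , b , gab , refl , refl) φa≡φb
  rewrite φ-injective φa≡φb = G-loopless b gab

Step : ℕ → ℕ → ℕ → ℕ → Set
Step m p s q = q ≡ p + s ⊎ q + m ≡ p + s

circ-loopless : ∀ {m} S → (∀ {s} → s ∈ S → 0 < s × s < m) → ∀ a → ¬ Circ m S a a
circ-loopless S bounds a (s , s∈S , step) with bounds s∈S
... | 0<s , s<m = [ no-step , no-step ]′ step
  where
  no-step : ¬ Step _ (toℕ a) s (toℕ a)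
  no-step (inj₁ eq) = <⇒≢ (m<m+n (toℕ a) 0<s) eq
  no-step (inj₂ eq) = <⇒≢ s<m (sym (+-cancelˡ-≡ (toℕ a) _ _ eq))

module Around {A : Set} (R : A → A → Set) (φ : ℕ → A) where

  private
    wraps-past : ∀ {m p q s} → p < m → q + m ≡ p + s → q < s
    wraps-past {m} {p} {q} {s} p<m eq = +-cancelʳ-< m q s (begin-strict
      q + m   ≡⟨ eq ⟩
      p + s   <⟨ +-monoˡ-< s p<m ⟩
      m + s   ≡⟨ +-comm m s ⟩
      s + m   ∎)
      where open ≤-Reasoning

  steps₁ : ∀ {m′} → (∀ p → suc p < suc m′ → R (φ p) (φ (suc p))) → R (φ m′) (φ 0) →
           ∀ p q → p < suc m′ → q < suc m′ → Step (suc m′) p 1 q → R (φ p) (φ q)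
  steps₁ next wrap p q p<m q<m (inj₁ refl) rewrite +-comm p 1 = next p q<m
  steps₁ next wrap p q p<m q<m (inj₂ eq) with wraps-past p<m eq
  ... | z<s rewrite suc-injective (trans eq (+-comm p 1)) = wrap

  steps₂ : ∀ {m″} → (∀ p → 2 + p < 2 + m″ → R (φ p) (φ (2 + p))) →
           R (φ m″) (φ 0) → R (φ (1 + m″)) (φ 1) →
           ∀ p q → p < 2 + m″ → q < 2 + m″ → Step (2 + m″) p 2 q → R (φ p) (φ q)
  steps₂ skip wrap₀ wrap₁ p q p<m q<m (inj₁ refl) rewrite +-comm p 2 = skip p q<m
  steps₂ skip wrap₀ wrap₁ p q p<m q<m (inj₂ eq) with wraps-past p<m eq
  ... | z<s rewrite suc-injective (suc-injective (trans eq (+-comm p 2))) = wrap₀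
  ... | s<s z<s rewrite suc-injective (suc-injective (trans eq (+-comm p 2))) = wrap₁

Joined : {V : Set} → ℕ → (ℕ → V) → ℕ → V → V → Set
Joined m φ s x y = ∃₂ λ p q → p < m × q < m × Step m p s q × φ p ≡ x × φ q ≡ y

module _ {V : Set} {φ : ℕ → V} where

  joined-next : ∀ {m} p → suc p < m → Joined m φ 1 (φ p) (φ (suc p))
  joined-next p p+1<m = p , suc p , <-trans (n<1+n p) p+1<m , p+1<m , inj₁ (+-comm 1 p) , refl , refl

  joined-skip : ∀ {m} p → 2 + p < m → Joined m φ 2 (φ p) (φ (2 + p))
  joined-skip p p+2<m =
    p , 2 + p , <-trans (≤-trans (n<1+n p) (n≤1+n _)) p+2<m , p+2<m , inj₁ (+-comm 2 p) , refl , refl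

  joined-wrap : ∀ m′ → Joined (suc m′) φ 1 (φ m′) (φ 0)
  joined-wrap m′ = m′ , 0 , ≤-refl , z<s , inj₂ (+-comm 1 m′) , refl , refl

  joined-wrap₀ : ∀ m″ → Joined (2 + m″) φ 2 (φ m″) (φ 0)
  joined-wrap₀ m″ = m″ , 0 , ≤-trans (n<1+n m″) (n≤1+n _) , z<s , inj₂ (+-comm 2 m″) , refl , refl

  joined-wrap₁ : ∀ m″ → Joined (2 + m″) φ 2 (φ (1 + m″)) (φ 1)
  joined-wrap₁ m″ = 1 + m″ , 1 , ≤-refl , s<s z<s , inj₂ (cong suc (+-comm 2 m″)) , refl , refl

-- A part given by its cyclic vertex sequence φ, with the vertices numbered by encode
module Lift {V : Set} (encode : V → ℕ) {m : ℕ} (φ : ℕ → V) (φ<m : ∀ p → encode (φ p) < m) where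

  lift : Fin m → Fin m
  lift a = fromℕ< (φ<m (toℕ a))

  toℕ-lift : ∀ a → toℕ (lift a) ≡ encode (φ (toℕ a))
  toℕ-lift a = toℕ-fromℕ< (φ<m (toℕ a))

  lift-injective : (ι : ℕ → ℕ) → (∀ p → p < m → ι (encode (φ p)) ≡ p) → Injective _≡_ _≡_ lift
  lift-injective ι ι-inverse {a} {b} eq = toℕ-injective (begin
    toℕ a                    ≡⟨ ι-inverse (toℕ a) (toℕ<n a) ⟨
    ι (encode (φ (toℕ a)))   ≡⟨ cong ι (trans (sym (toℕ-lift a)) (trans (cong toℕ eq) (toℕ-lift b))) ⟩
    ι (encode (φ (toℕ b)))   ≡⟨ ι-inverse (toℕ b) (toℕ<n b) ⟩
    toℕ b                    ∎)
    where open ≡-Reasoning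

  image-sound : (R : V → V → Set) → (∀ {x y} → R x y → R y x) → ∀ {S} →
                (∀ {s} → s ∈ S → ∀ p q → p < m → q < m → Step m p s q → R (φ p) (φ q)) →
                ∀ u v → Image lift (Circ m S) u v →
                ∃₂ λ x y → R x y × encode x ≡ toℕ u × encode y ≡ toℕ v
  image-sound R R-sym steps u v (a , b , (s , s∈S , st) , refl , refl) with st
  ... | inj₁ a→b = _ , _ , steps s∈S _ _ (toℕ<n a) (toℕ<n b) a→b , sym (toℕ-lift a) , sym (toℕ-lift b)
  ... | inj₂ b→a =
    _ , _ , R-sym (steps s∈S _ _ (toℕ<n b) (toℕ<n a) b→a) , sym (toℕ-lift a) , sym (toℕ-lift b)

  private
    at : ∀ {s p q} (p<m : p < m) (q<m : q < m) → Step m p s q →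
         Step m (toℕ (fromℕ< p<m)) s (toℕ (fromℕ< q<m))
    at p<m q<m = subst₂ (λ p q → Step m p _ q) (sym (toℕ-fromℕ< p<m)) (sym (toℕ-fromℕ< q<m))

    lands : ∀ {p x w} (p<m : p < m) → φ p ≡ x → encode x ≡ toℕ w → lift (fromℕ< p<m) ≡ w
    lands p<m refl x↦w =
      toℕ-injective (trans (toℕ-lift _) (trans (cong (encode ∘ φ) (toℕ-fromℕ< p<m)) x↦w))

  image-joined : ∀ {S s x y} → s ∈ S → ∀ {u v} → encode x ≡ toℕ u → encode y ≡ toℕ v →
                 Joined m φ s x y ⊎ Joined m φ s y x → Image lift (Circ m S) u v
  image-joined s∈S x↦u y↦v (inj₁ (p , q , p<m , q<m , st , φp , φq)) =
    fromℕ< p<m , fromℕ< q<m , (_ , s∈S , inj₁ (at p<m q<m st)) , lands p<m φp x↦u , lands q<m φq y↦v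
  image-joined s∈S x↦u y↦v (inj₂ (p , q , p<m , q<m , st , φp , φq)) =
    fromℕ< q<m , fromℕ< p<m , (_ , s∈S , inj₂ (at p<m q<m st)) , lands q<m φq x↦u , lands p<m φp y↦v

CyclesAndSquare : ℕ → ℕ → Set
CyclesAndSquare m t =
  Σ (Fin t → Fin m → Fin m) λ cyc →
  Σ (Fin m → Fin m) λ ψ →
    (∀ i → Injective _≡_ _≡_ (cyc i)) ×
    Injective _≡_ _≡_ ψ ×
    IsDecompositionOfK m (suc t) (Parts m t cyc ψ)

-- Walecki's Hamiltonian paths

data Half : ℕ → Set where
  even : ∀ a → Half (a + a)
  odd  : ∀ a → Half (suc (a + a))

half : ∀ t → Half t
half zero = even 0
half (suc zero) = odd 0
half (suc (suc t)) with half t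
... | even a = subst Half (cong suc (+-suc a a)) (even (suc a))
... | odd a  = subst Half (cong (suc ∘ suc) (+-suc a a)) (odd (suc a))

parity-even : ∀ a → parity (a + a) ≡ 0ℙ
parity-even a = trans (Parity.+-homo-+ a a) (p+p≡0ℙ (parity a))

parity-odd : ∀ a → parity (suc (a + a)) ≡ 1ℙ
parity-odd a = trans (Parity.+-homo-+ 1 (a + a)) (cong (1ℙ ℙ.+_) (parity-even a))

⌊a+a/2⌋≡a : ∀ a → ⌊ a + a /2⌋ ≡ a
⌊a+a/2⌋≡a a = sym (n≡⌊n+n/2⌋ a)

⌊1+a+a/2⌋≡a : ∀ a → ⌊ suc (a + a) /2⌋ ≡ a
⌊1+a+a/2⌋≡a a = sym (n≡⌈n+n/2⌉ a)

⌊e+a+a/2⌋≡a : ∀ {e} a → e ≤ 1 → ⌊ e + (a + a) /2⌋ ≡ a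
⌊e+a+a/2⌋≡a a z≤n = ⌊a+a/2⌋≡a a
⌊e+a+a/2⌋≡a a (s≤s z≤n) = ⌊1+a+a/2⌋≡a a

≤-half : ∀ {a c} → a + a ≤ c → a ≤ ⌊ c /2⌋
≤-half {a} a+a≤c = subst (_≤ _) (⌊a+a/2⌋≡a a) (⌊n/2⌋-mono a+a≤c)

halve : ∀ t → ∃[ e ] e ≤ 1 × t ≡ e + (⌊ t /2⌋ + ⌊ t /2⌋)
halve t with half t
... | even a = 0 , z≤n , cong (λ x → x + x) (sym (⌊a+a/2⌋≡a a))
... | odd a = 1 , s≤s z≤n , cong (λ x → suc (x + x)) (sym (⌊1+a+a/2⌋≡a a))

module Walecki (k : ℕ) where

  n : ℕ
  n = 2 + (k + k)

  last : ℕ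
  last = suc (k + k)

  -- the offsets 0, 1, −1, 2, −2, … , k + 1 modulo n, with the offset 0 represented by n
  zigzag : ℕ → ℕ
  zigzag t with parity t
  ... | 0ℙ = n ∸ ⌊ t /2⌋
  ... | 1ℙ = suc ⌊ t /2⌋

  unzigzag : ℕ → ℕ
  unzigzag zero = zero
  unzigzag (suc o) with o ≤? k
  ... | yes _ = suc (o + o)
  ... | no _  = (last ∸ o) + (last ∸ o)

  path : ℕ → ℕ → ℕ
  path j t = (j + zigzag t) % n

  position : ℕ → ℕ → ℕ
  position j v = unzigzag ((v + (n ∸ j)) % n)

  pathOf : ℕ → ℕ → ℕ
  pathOf u v = ⌊ (u + v) % n /2⌋

  path<n : ∀ j t → path j t < n
  path<n j t = m%n<n (j + zigzag t) n

  ≤k⇒≤n : ∀ {j} → j ≤ k → j ≤ n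
  ≤k⇒≤n j≤k = ≤-trans j≤k (≤-trans (m≤m+n k k) (m≤n+m (k + k) 2))

  ≤k⇒<n : ∀ {a} → a ≤ k → suc a < n
  ≤k⇒<n a≤k = s≤s (s≤s (≤-trans a≤k (m≤m+n k k)))

  <k⇒<n : ∀ {j} → j < k → j < n
  <k⇒<n j<k = ≤-trans j<k (≤k⇒≤n ≤-refl)

  k<n : k < n
  k<n = ≤-trans (n≤1+n _) (≤k⇒<n ≤-refl)

  even<n : ∀ {a} → a + a < n → a ≤ k
  even<n {a} lt = subst (a ≤_) (⌊1+a+a/2⌋≡a k) (≤-half (s≤s⁻¹ lt))

  odd<n : ∀ {a} → suc (a + a) < n → a ≤ k
  odd<n {a} lt = subst (a ≤_) (⌊a+a/2⌋≡a k) (≤-half (s≤s⁻¹ (s≤s⁻¹ lt)))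

  last∸k : last ∸ k ≡ suc k
  last∸k = trans (+-∸-assoc 1 (m≤m+n k k)) (cong suc (m+n∸m≡n k k))

  zigzag-even : ∀ a → zigzag (a + a) ≡ n ∸ a
  zigzag-even a rewrite parity-even a = cong (n ∸_) (⌊a+a/2⌋≡a a)

  zigzag-odd : ∀ a → zigzag (suc (a + a)) ≡ suc a
  zigzag-odd a rewrite parity-odd a = cong suc (⌊1+a+a/2⌋≡a a)

  zigzag-step : ∀ t → suc t < n → ∃[ e ] e ≤ 1 × zigzag t + zigzag (suc t) ≡ e + n
  zigzag-step t t+1<n with half t
  ... | even a = 1 , s≤s z≤n , (begin
    zigzag (a + a) + zigzag (suc (a + a))   ≡⟨ cong₂ _+_ (zigzag-even a) (zigzag-odd a) ⟩
    (n ∸ a) + suc a                         ≡⟨ +-suc (n ∸ a) a ⟩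
    suc ((n ∸ a) + a)                       ≡⟨ cong suc (m∸n+n≡m (≤-trans (m≤m+n a a) t≤n)) ⟩
    suc n                                   ∎)
    where
    open ≡-Reasoning
    t≤n = <⇒≤ (<-trans (n<1+n _) t+1<n)
  ... | odd a = 0 , z≤n , (begin
    zigzag (suc (a + a)) + zigzag (suc (suc (a + a)))  ≡⟨ cong₂ _+_ (zigzag-odd a) next ⟩
    suc a + (n ∸ suc a)                                ≡⟨ m+[n∸m]≡n (≤-trans (s≤s (m≤m+n a a)) t≤n) ⟩
    n                                                  ∎)
    where
    open ≡-Reasoning
    t≤n = <⇒≤ (<-trans (n<1+n _) t+1<n)
    next : zigzag (suc (suc (a + a))) ≡ n ∸ suc a
    next = trans (cong (zigzag ∘ suc) (sym (+-suc a a))) (zigzag-even (suc a))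

  unzigzag-low : ∀ {c} → c ≤ k → unzigzag (suc c) ≡ suc (c + c)
  unzigzag-low {c} c≤k with c ≤? k
  ... | yes _ = refl
  ... | no c≰k = ⊥-elim (c≰k c≤k)

  unzigzag-high : ∀ {c} → k < c → unzigzag (suc c) ≡ (last ∸ c) + (last ∸ c)
  unzigzag-high {c} k<c with c ≤? k
  ... | yes c≤k = ⊥-elim (<⇒≱ k<c c≤k)
  ... | no _ = refl

  unzigzag<n : ∀ o → o < n → unzigzag o < n
  unzigzag<n zero _ = z<s
  unzigzag<n (suc c) _ with c ≤? k
  ... | yes c≤k = s≤s (s≤s (+-mono-≤ c≤k c≤k))
  ... | no c≰k = ≤-trans (s≤s (+-mono-≤ b≤k b≤k)) (n≤1+n _)
    where
    b≤k : last ∸ c ≤ k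
    b≤k = subst (last ∸ c ≤_) (m+n∸m≡n k k) (∸-monoʳ-≤ last (≰⇒> c≰k))

  unzigzag-zigzag : ∀ t → t < n → unzigzag (zigzag t % n) ≡ t
  unzigzag-zigzag t t<n with half t
  ... | even zero = cong unzigzag (n%n≡0 n)
  ... | even (suc a) = begin
    unzigzag (zigzag (suc a + suc a) % n)   ≡⟨ cong (λ x → unzigzag (x % n)) (zigzag-even (suc a)) ⟩
    unzigzag ((last ∸ a) % n)               ≡⟨ cong unzigzag (m<n⇒m%n≡m (s≤s (m∸n≤m last a))) ⟩
    unzigzag (last ∸ a)                     ≡⟨ cong unzigzag (+-∸-assoc 1 a≤k+k) ⟩
    unzigzag (suc (k + k ∸ a))              ≡⟨ unzigzag-high k<k+k∸a ⟩
    b + b                                   ≡⟨ cong (λ x → x + x) b≡1+a ⟩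
    suc a + suc a                           ∎
    where
    open ≡-Reasoning
    a<k : a < k
    a<k = even<n t<n
    a≤k+k : a ≤ k + k
    a≤k+k = ≤-trans (<⇒≤ a<k) (m≤m+n k k)
    b = last ∸ (k + k ∸ a)
    b≡1+a : b ≡ suc a
    b≡1+a = trans (+-∸-assoc 1 (m∸n≤m (k + k) a)) (cong suc (m∸[m∸n]≡n a≤k+k))
    k<k+k∸a : k < k + k ∸ a
    k<k+k∸a = subst (k <_) (sym (+-∸-assoc k (<⇒≤ a<k))) (m<m+n k (m<n⇒0<n∸m a<k))
  ... | odd a = begin
    unzigzag (zigzag (suc (a + a)) % n)   ≡⟨ cong (λ x → unzigzag (x % n)) (zigzag-odd a) ⟩
    unzigzag (suc a % n)                  ≡⟨ cong unzigzag (m<n⇒m%n≡m (≤k⇒<n a≤k)) ⟩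
    unzigzag (suc a)                      ≡⟨ unzigzag-low a≤k ⟩
    suc (a + a)                           ∎
    where
    open ≡-Reasoning
    a≤k : a ≤ k
    a≤k = odd<n t<n

  zigzag-unzigzag : ∀ o → o < n → zigzag (unzigzag o) % n ≡ o
  zigzag-unzigzag zero _ = n%n≡0 n
  zigzag-unzigzag (suc c) o<n with c ≤? k
  ... | yes c≤k = trans (cong (_% n) (zigzag-odd c)) (m<n⇒m%n≡m o<n)
  ... | no c≰k = begin
    zigzag (b + b) % n   ≡⟨ cong (_% n) (zigzag-even b) ⟩
    (n ∸ b) % n          ≡⟨ cong (_% n) (+-∸-assoc 1 (m∸n≤m last c)) ⟩
    suc (last ∸ b) % n   ≡⟨ cong (λ x → suc x % n) (m∸[m∸n]≡n (<⇒≤ (s≤s⁻¹ o<n))) ⟩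
    suc c % n            ≡⟨ m<n⇒m%n≡m o<n ⟩
    suc c                ∎
    where
    open ≡-Reasoning
    b = last ∸ c

  mod-split : ∀ {x e} → x < n + n → x % n ≡ e → x ≡ e ⊎ x ≡ e + n
  mod-split {x} {e} x<n+n x%n≡e with x <? n
  ... | yes x<n = inj₁ (trans (sym (m<n⇒m%n≡m x<n)) x%n≡e)
  ... | no x≮n = inj₂ (begin
    x             ≡⟨ m∸n+n≡m n≤x ⟨
    (x ∸ n) + n   ≡⟨ cong (_+ n) x∸n≡e ⟩
    e + n         ∎)
    where
    open ≡-Reasoning
    n≤x = ≮⇒≥ x≮n
    x∸n<n : x ∸ n < n
    x∸n<n = +-cancelʳ-< n (x ∸ n) n (subst (_< n + n) (sym (m∸n+n≡m n≤x)) x<n+n)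
    x∸n≡e : x ∸ n ≡ e
    x∸n≡e = begin
      x ∸ n             ≡⟨ m<n⇒m%n≡m x∸n<n ⟨
      (x ∸ n) % n       ≡⟨ [m+n]%n≡m%n (x ∸ n) n ⟨
      (x ∸ n + n) % n   ≡⟨ cong (_% n) (m∸n+n≡m n≤x) ⟩
      x % n             ≡⟨ x%n≡e ⟩
      e                 ∎

  Consecutive : ℕ → ℕ → Set
  Consecutive a b = suc a ≡ b ⊎ suc b ≡ a

  private
    consecutive-low : ∀ {c c′ e} → c ≤ k → e ≤ 1 → c + c′ ≡ e + (k + k) → c ≢ c′ →
                      Consecutive (unzigzag (suc c)) (unzigzag (suc c′))
    consecutive-low {c} {c′} c≤k z≤n c+c′≡k+k c≢c′ with m≤n⇒m<n∨m≡n c≤k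
    ... | inj₂ refl = ⊥-elim (c≢c′ (+-cancelˡ-≡ k k c′ (sym c+c′≡k+k)))
    ... | inj₁ c<k = inj₁ (begin
      suc (unzigzag (suc c))   ≡⟨ cong suc (unzigzag-low c≤k) ⟩
      suc (suc (c + c))        ≡⟨ cong suc (+-suc c c) ⟨
      suc c + suc c            ≡⟨ cong (λ x → x + x) b≡1+c ⟨
      b + b                    ≡⟨ unzigzag-high k<c′ ⟨
      unzigzag (suc c′)        ∎)
      where
      open ≡-Reasoning
      c′≡ : c′ ≡ k + k ∸ c
      c′≡ = trans (sym (m+n∸m≡n c c′)) (cong (_∸ c) c+c′≡k+k)
      k<c′ : k < c′
      k<c′ = subst (k <_) (sym (trans c′≡ (+-∸-assoc k (<⇒≤ c<k)))) (m<m+n k (m<n⇒0<n∸m c<k))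
      b = last ∸ c′
      b≡1+c : b ≡ suc c
      b≡1+c = begin
        suc (k + k) ∸ c′    ≡⟨ +-∸-assoc 1 (subst (c′ ≤_) c+c′≡k+k (m≤n+m c′ c)) ⟩
        suc (k + k ∸ c′)    ≡⟨ cong (λ x → suc (x ∸ c′)) c+c′≡k+k ⟨
        suc (c + c′ ∸ c′)   ≡⟨ cong suc (m+n∸n≡m c c′) ⟩
        suc c               ∎
    consecutive-low {c} {c′} c≤k (s≤s z≤n) c+c′≡last c≢c′ = inj₂ (begin
      suc (unzigzag (suc c′))   ≡⟨ cong suc (unzigzag-high k<c′) ⟩
      suc (b + b)               ≡⟨ cong (λ x → suc (x + x)) b≡c ⟩
      suc (c + c)               ≡⟨ unzigzag-low c≤k ⟨
      unzigzag (suc c)          ∎)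
      where
      open ≡-Reasoning
      b = last ∸ c′
      b≡c : b ≡ c
      b≡c = trans (cong (_∸ c′) (sym c+c′≡last)) (m+n∸n≡m c c′)
      k<c′ : k < c′
      k<c′ = subst (k <_) (sym (trans (sym (m+n∸m≡n c c′)) (cong (_∸ c) c+c′≡last)))
                   (subst (_≤ last ∸ c) last∸k (∸-monoʳ-≤ last c≤k))

    consecutive-positive : ∀ {c c′ e} → e ≤ 1 → c + c′ ≡ e + (k + k) → c ≢ c′ →
                           Consecutive (unzigzag (suc c)) (unzigzag (suc c′))
    consecutive-positive {c} {c′} {e} e≤1 c+c′ c≢c′ with k <? c
    ... | no k≮c = consecutive-low (≮⇒≥ k≮c) e≤1 c+c′ c≢c′
    ... | yes k<c = swap (consecutive-low c′≤k e≤1 (trans (+-comm c′ c) c+c′) (c≢c′ ∘ sym))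
      where
      c′≤k : c′ ≤ k
      c′≤k = +-cancelˡ-≤ (suc k) c′ k (begin
        suc k + c′    ≤⟨ +-monoˡ-≤ c′ k<c ⟩
        c + c′        ≡⟨ c+c′ ⟩
        e + (k + k)   ≤⟨ +-monoˡ-≤ (k + k) e≤1 ⟩
        suc (k + k)   ∎)
        where open ≤-Reasoning

    consecutive-zero : ∀ c {e} → suc c < n → e ≤ 1 → suc c % n ≡ e →
                       Consecutive (unzigzag 0) (unzigzag (suc c))
    consecutive-zero c c<n e≤1 sum with mod-split (<-trans c<n (m<m+n n z<s)) sum
    consecutive-zero zero c<n _ sum | inj₁ refl = inj₁ (sym (unzigzag-low z≤n))
    consecutive-zero (suc c) c<n (s≤s ()) sum | inj₁ refl
    ... | inj₂ eq = ⊥-elim (<⇒≱ c<n (subst (n ≤_) (sym eq) (m≤n+m n _)))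

  unzigzag-consecutive : ∀ o o′ {e} → o < n → o′ < n → o ≢ o′ → e ≤ 1 → (o + o′) % n ≡ e →
                         Consecutive (unzigzag o) (unzigzag o′)
  unzigzag-consecutive zero zero _ _ o≢o′ _ _ = ⊥-elim (o≢o′ refl)
  unzigzag-consecutive zero (suc c′) _ o′<n _ e≤1 sum = consecutive-zero c′ o′<n e≤1 sum
  unzigzag-consecutive (suc c) zero o<n _ _ e≤1 sum =
    swap (consecutive-zero c o<n e≤1 (trans (cong (_% n) (sym (+-identityʳ (suc c)))) sum))
  unzigzag-consecutive (suc c) (suc c′) {e} o<n o′<n o≢o′ e≤1 sum
    with mod-split (+-mono-< o<n o′<n) sum
  ... | inj₁ refl with m+n≤o⇒n≤o c (s≤s⁻¹ e≤1)
  ...   | ()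
  unzigzag-consecutive (suc c) (suc c′) {e} o<n o′<n o≢o′ e≤1 sum | inj₂ eq =
    consecutive-positive e≤1 c+c′ (o≢o′ ∘ cong suc)
    where
    c+c′ : c + c′ ≡ e + (k + k)
    c+c′ = suc-injective (suc-injective (begin
      suc (suc (c + c′))        ≡⟨ cong suc (+-suc c c′) ⟨
      suc c + suc c′            ≡⟨ eq ⟩
      e + n                     ≡⟨ +-suc e _ ⟩
      suc (e + suc (k + k))     ≡⟨ cong suc (+-suc e _) ⟩
      suc (suc (e + (k + k)))   ∎))
      where open ≡-Reasoning

  mod-absorbˡ : ∀ a c → (a % n + c) % n ≡ (a + c) % n
  mod-absorbˡ a c = begin
    (a % n + c) % n           ≡⟨ %-distribˡ-+ (a % n) c n ⟩
    (a % n % n + c % n) % n   ≡⟨ cong (λ x → (x + c % n) % n) (m%n%n≡m%n a n) ⟩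
    (a % n + c % n) % n       ≡⟨ %-distribˡ-+ a c n ⟨
    (a + c) % n               ∎
    where open ≡-Reasoning

  mod-absorbʳ : ∀ a c → (a + c % n) % n ≡ (a + c) % n
  mod-absorbʳ a c = begin
    (a + c % n) % n   ≡⟨ cong (_% n) (+-comm a (c % n)) ⟩
    (c % n + a) % n   ≡⟨ mod-absorbˡ c a ⟩
    (c + a) % n       ≡⟨ cong (_% n) (+-comm c a) ⟩
    (a + c) % n       ∎
    where open ≡-Reasoning

  turn : ∀ j x → j ≤ n → j + x + (n ∸ j) ≡ x + n
  turn j x j≤n = begin
    j + x + (n ∸ j)     ≡⟨ cong (_+ (n ∸ j)) (+-comm j x) ⟩
    x + j + (n ∸ j)     ≡⟨ +-assoc x j (n ∸ j) ⟩
    x + (j + (n ∸ j))   ≡⟨ cong (x +_) (m+[n∸m]≡n j≤n) ⟩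
    x + n               ∎
    where open ≡-Reasoning

  shift-back : ∀ {j} x → j ≤ n → ((j + x) % n + (n ∸ j)) % n ≡ x % n
  shift-back {j} x j≤n = begin
    ((j + x) % n + (n ∸ j)) % n   ≡⟨ mod-absorbˡ (j + x) (n ∸ j) ⟩
    (j + x + (n ∸ j)) % n         ≡⟨ cong (_% n) (turn j x j≤n) ⟩
    (x + n) % n                   ≡⟨ [m+n]%n≡m%n x n ⟩
    x % n                         ∎
    where open ≡-Reasoning

  shift-forth : ∀ {j} x → j ≤ n → (j + (x + (n ∸ j)) % n) % n ≡ x % n
  shift-forth {j} x j≤n = begin
    (j + (x + (n ∸ j)) % n) % n   ≡⟨ mod-absorbʳ j (x + (n ∸ j)) ⟩
    (j + (x + (n ∸ j))) % n       ≡⟨ cong (_% n) (+-assoc j x (n ∸ j)) ⟨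
    (j + x + (n ∸ j)) % n         ≡⟨ cong (_% n) (turn j x j≤n) ⟩
    (x + n) % n                   ≡⟨ [m+n]%n≡m%n x n ⟩
    x % n                         ∎
    where open ≡-Reasoning

  position-path : ∀ {j} t → j ≤ n → t < n → position j (path j t) ≡ t
  position-path t j≤n t<n = trans (cong unzigzag (shift-back (zigzag t) j≤n)) (unzigzag-zigzag t t<n)

  path-position : ∀ {j} v → j ≤ n → v < n → path j (position j v) ≡ v
  path-position {j} v j≤n v<n = begin
    (j + zigzag (unzigzag o)) % n       ≡⟨ mod-absorbʳ j (zigzag (unzigzag o)) ⟨
    (j + zigzag (unzigzag o) % n) % n   ≡⟨ cong (λ x → (j + x) % n) (zigzag-unzigzag o o<n) ⟩
    (j + o) % n                         ≡⟨ shift-forth v j≤n ⟩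
    v % n                               ≡⟨ m<n⇒m%n≡m v<n ⟩
    v                                   ∎
    where
    open ≡-Reasoning
    o = (v + (n ∸ j)) % n
    o<n = m%n<n (v + (n ∸ j)) n

  pathOf-path : ∀ {j} t → j ≤ k → suc t < n → pathOf (path j t) (path j (suc t)) ≡ j
  pathOf-path {j} t j≤k t+1<n with zigzag-step t t+1<n
  ... | e , e≤1 , step = trans (cong ⌊_/2⌋ sum) (⌊e+a+a/2⌋≡a j e≤1)
    where
    open ≡-Reasoning
    sum : (path j t + path j (suc t)) % n ≡ e + (j + j)
    sum = begin
      ((j + zigzag t) % n + (j + zigzag (suc t)) % n) % n  ≡⟨ %-distribˡ-+ (j + zigzag t) _ n ⟨
      ((j + zigzag t) + (j + zigzag (suc t))) % n          ≡⟨ cong (_% n) (interchange j _ j _) ⟩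
      ((j + j) + (zigzag t + zigzag (suc t))) % n          ≡⟨ cong (λ x → ((j + j) + x) % n) step ⟩
      ((j + j) + (e + n)) % n                              ≡⟨ cong (_% n) (+-assoc (j + j) e n) ⟨
      ((j + j) + e + n) % n                                ≡⟨ [m+n]%n≡m%n ((j + j) + e) n ⟩
      ((j + j) + e) % n                                    ≡⟨ cong (_% n) (+-comm (j + j) e) ⟩
      (e + (j + j)) % n                                    ≡⟨ m<n⇒m%n≡m (s≤s (+-mono-≤ e≤1 (+-mono-≤ j≤k j≤k))) ⟩
      e + (j + j)                                          ∎

  offset-sum : ∀ {j e} u v → j ≤ n → e < n → (u + v) % n ≡ e + (j + j) →
               ((u + (n ∸ j)) % n + (v + (n ∸ j)) % n) % n ≡ e
  offset-sum {j} {e} u v j≤n e<n u+v = begin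
    ((u + r) % n + (v + r) % n) % n   ≡⟨ %-distribˡ-+ (u + r) (v + r) n ⟨
    ((u + r) + (v + r)) % n           ≡⟨ cong (_% n) (interchange u r v r) ⟩
    ((u + v) + (r + r)) % n           ≡⟨ mod-absorbˡ (u + v) (r + r) ⟨
    ((u + v) % n + (r + r)) % n       ≡⟨ cong (λ x → (x + (r + r)) % n) u+v ⟩
    (e + (j + j) + (r + r)) % n       ≡⟨ cong (_% n) (+-assoc e (j + j) (r + r)) ⟩
    (e + ((j + j) + (r + r))) % n     ≡⟨ cong (λ x → (e + x) % n) (interchange j j r r) ⟩
    (e + ((j + r) + (j + r))) % n     ≡⟨ cong (λ x → (e + (x + x)) % n) (m+[n∸m]≡n j≤n) ⟩
    (e + (n + n)) % n                 ≡⟨ cong (_% n) (+-assoc e n n) ⟨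
    (e + n + n) % n                   ≡⟨ [m+n]%n≡m%n (e + n) n ⟩
    (e + n) % n                       ≡⟨ [m+n]%n≡m%n e n ⟩
    e % n                             ≡⟨ m<n⇒m%n≡m e<n ⟩
    e                                 ∎
    where
    open ≡-Reasoning
    r = n ∸ j

  PathEdge : ℕ → ℕ → ℕ → ℕ → Set
  PathEdge j t u v = (path j t ≡ u × path j (suc t) ≡ v) ⊎ (path j t ≡ v × path j (suc t) ≡ u)

  pathOf≤k : ∀ u v → pathOf u v ≤ k
  pathOf≤k u v = subst (pathOf u v ≤_) (⌊1+a+a/2⌋≡a k) (⌊n/2⌋-mono (s≤s⁻¹ (m%n<n (u + v) n)))

  pathOf-edge : ∀ u v → u < n → v < n → u ≢ v → ∃[ t ] suc t < n × PathEdge (pathOf u v) t u v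
  pathOf-edge u v u<n v<n u≢v with halve ((u + v) % n)
  ... | e , e≤1 , u+v = finish (unzigzag-consecutive o o′ (o<n u) (o<n v) o≢o′ e≤1
                                  (offset-sum u v j≤n (≤-<-trans e≤1 (s≤s (s≤s z≤n))) u+v))
    where
    j = pathOf u v
    j≤n = ≤k⇒≤n (pathOf≤k u v)
    o = (u + (n ∸ j)) % n
    o′ = (v + (n ∸ j)) % n
    o<n : ∀ w → (w + (n ∸ j)) % n < n
    o<n w = m%n<n (w + (n ∸ j)) n
    o≢o′ : o ≢ o′
    o≢o′ o≡o′ = u≢v (begin
      u                      ≡⟨ path-position u j≤n u<n ⟨
      path j (unzigzag o)    ≡⟨ cong (path j ∘ unzigzag) o≡o′ ⟩
      path j (unzigzag o′)   ≡⟨ path-position v j≤n v<n ⟩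
      v                      ∎)
      where open ≡-Reasoning
    finish : Consecutive (unzigzag o) (unzigzag o′) → ∃[ t ] suc t < n × PathEdge j t u v
    finish (inj₁ next) = unzigzag o , subst (_< n) (sym next) (unzigzag<n o′ (o<n v)) ,
                         inj₁ (path-position u j≤n u<n , trans (cong (path j) next) (path-position v j≤n v<n))
    finish (inj₂ next) = unzigzag o′ , subst (_< n) (sym next) (unzigzag<n o (o<n u)) ,
                         inj₂ (path-position v j≤n v<n , trans (cong (path j) next) (path-position u j≤n u<n))

  path-start : ∀ {j} → j < n → path j 0 ≡ j
  path-start {j} j<n = trans ([m+n]%n≡m%n j n) (m<n⇒m%n≡m j<n)

  path-odd : ∀ {j} a → j + suc a < n → path j (suc (a + a)) ≡ j + suc a
  path-odd {j} a lt = trans (cong (λ x → (j + x) % n) (zigzag-odd a)) (m<n⇒m%n≡m lt)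

  path-even-low : ∀ {j a} → a ≤ j → j < n → path j (a + a) ≡ j ∸ a
  path-even-low {j} {a} a≤j j<n = begin
    (j + zigzag (a + a)) % n        ≡⟨ cong (λ x → (j + x) % n) (zigzag-even a) ⟩
    (j + (n ∸ a)) % n               ≡⟨ cong (λ x → (x + (n ∸ a)) % n) (m∸n+n≡m a≤j) ⟨
    ((j ∸ a) + a + (n ∸ a)) % n     ≡⟨ cong (_% n) (+-assoc (j ∸ a) a (n ∸ a)) ⟩
    ((j ∸ a) + (a + (n ∸ a))) % n   ≡⟨ cong (λ x → ((j ∸ a) + x) % n) (m+[n∸m]≡n (≤-trans a≤j (<⇒≤ j<n))) ⟩
    ((j ∸ a) + n) % n               ≡⟨ [m+n]%n≡m%n (j ∸ a) n ⟩
    (j ∸ a) % n                     ≡⟨ m<n⇒m%n≡m (≤-<-trans (m∸n≤m j a) j<n) ⟩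
    j ∸ a                           ∎
    where open ≡-Reasoning

  path-even-high : ∀ {j a} → j < a → a ≤ n → path j (a + a) ≡ j + (n ∸ a)
  path-even-high {j} {a} j<a a≤n = trans (cong (λ x → (j + x) % n) (zigzag-even a)) (m<n⇒m%n≡m lt)
    where
    open ≤-Reasoning
    lt : j + (n ∸ a) < n
    lt = begin-strict
      j + (n ∸ a)   <⟨ +-monoˡ-< (n ∸ a) j<a ⟩
      a + (n ∸ a)   ≡⟨ m+[n∸m]≡n a≤n ⟩
      n             ∎

  path-second : ∀ {j} → suc j < n → path j 1 ≡ suc j
  path-second {j} lt = trans (path-odd 0 (subst (_< n) (+-comm 1 j) lt)) (+-comm j 1)

  path-end : ∀ {j} → j ≤ k → path j last ≡ suc k + j
  path-end {j} j≤k =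
    trans (path-odd k (subst (_< n) (sym (+-suc j k)) (s≤s (s≤s (+-monoˡ-≤ k j≤k))))) (+-comm j (suc k))

  path-penultimate : ∀ {j} → j < k → path j (k + k) ≡ 2 + k + j
  path-penultimate {j} j<k = begin
    path j (k + k)   ≡⟨ path-even-high j<k (≤k⇒≤n ≤-refl) ⟩
    j + (n ∸ k)      ≡⟨ cong (j +_) (trans (+-∸-assoc 2 (m≤m+n k k)) (cong (2 +_) (m+n∸m≡n k k))) ⟩
    j + (2 + k)      ≡⟨ +-comm j (2 + k) ⟩
    2 + k + j        ∎
    where open ≡-Reasoning

-- The cycles and the square

data Hub : Set where
  ∞ X Y : Hub

data Vertex : Set where
  fin : ℕ → Vertex
  hub : Hub → Vertex

encode : Vertex → ℕ
encode (hub Y) = 0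
encode (hub ∞) = 1
encode (hub X) = 2
encode (fin v) = 3 + v

decode : ℕ → Vertex
decode 0 = hub Y
decode 1 = hub ∞
decode 2 = hub X
decode (suc (suc (suc v))) = fin v

decode-encode : ∀ w → decode (encode w) ≡ w
decode-encode (fin v) = refl
decode-encode (hub ∞) = refl
decode-encode (hub X) = refl
decode-encode (hub Y) = refl

encode-decode : ∀ p → encode (decode p) ≡ p
encode-decode 0 = refl
encode-decode 1 = refl
encode-decode 2 = refl
encode-decode (suc (suc (suc v))) = refl

module Construction (k : ℕ) where
  open Walecki k

  m : ℕ
  m = 3 + n

  cycle : ℕ → ℕ → Vertex
  cycle j 0 = hub X
  cycle j 1 = fin (path j 0)
  cycle j 2 = hub ∞
  cycle j 3 = fin (path j last)
  cycle j 4 = hub Y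
  cycle j (suc (suc (suc (suc (suc t))))) = fin (path j (suc t))

  square : ℕ → Vertex
  square 0 = hub Y
  square 1 = hub ∞
  square 2 = hub X
  square (suc (suc (suc t))) = fin (path k t)

  window : ℕ → ℕ → Maybe ℕ
  window c u with c ≤? u | u <? c + k
  ... | yes _ | yes _ = just (u ∸ c)
  ... | _     | _     = nothing

  window-hit : ∀ c {j} → j < k → window c (c + j) ≡ just j
  window-hit c {j} j<k with c ≤? c + j | c + j <? c + k
  ... | yes _    | yes _ = cong just (m+n∸m≡n c j)
  ... | no c≰c+j | _     = ⊥-elim (c≰c+j (m≤m+n c j))
  ... | yes _    | no ≮  = ⊥-elim (≮ (+-monoʳ-< c j<k))

  window-miss : ∀ {c u} → u < c ⊎ c + k ≤ u → window c u ≡ nothing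
  window-miss {c} {u} outside with c ≤? u | u <? c + k | outside
  ... | yes c≤u | yes _     | inj₁ u<c   = ⊥-elim (<⇒≱ u<c c≤u)
  ... | yes _   | yes u<c+k | inj₂ c+k≤u = ⊥-elim (<⇒≱ u<c+k c+k≤u)
  ... | yes _   | no _      | _          = refl
  ... | no _    | _         | _          = refl

  -- the part of the edge from a hub to u, for a hub joined to c₁ + j and c₂ + j on each cycle j < k
  attachment : ℕ → ℕ → ℕ → ℕ
  attachment c₁ c₂ u = fromMaybe k (window c₁ u <∣> window c₂ u)

  attachment-first : ∀ c₁ c₂ {j} → j < k → attachment c₁ c₂ (c₁ + j) ≡ j
  attachment-first c₁ c₂ j<k rewrite window-hit c₁ j<k = refl

  attachment-second : ∀ c₁ c₂ {j} → c₁ + k ≤ c₂ → j < k → attachment c₁ c₂ (c₂ + j) ≡ j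
  attachment-second c₁ c₂ {j} c₁+k≤c₂ j<k
    rewrite window-miss {c₁} (inj₂ (≤-trans c₁+k≤c₂ (m≤m+n c₂ j))) | window-hit c₂ j<k = refl

  attachment-none : ∀ c₁ c₂ {u} → u < c₁ ⊎ c₁ + k ≤ u → u < c₂ ⊎ c₂ + k ≤ u →
                    attachment c₁ c₂ u ≡ k
  attachment-none c₁ c₂ out₁ out₂ rewrite window-miss {c₁} out₁ | window-miss {c₂} out₂ = refl

  hubPart : Hub → ℕ → ℕ
  hubPart ∞ = attachment 0 (1 + k)
  hubPart X = attachment 0 (2 + k)
  hubPart Y = attachment 1 (1 + k)

  edgePart : ℕ → ℕ → ℕ
  edgePart j zero = k
  edgePart j (suc t) with suc t ≟ k + k
  ... | yes _ = k
  ... | no _ = j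

  finPart : ℕ → ℕ → ℕ
  finPart u v = edgePart (pathOf u v) (position (pathOf u v) u ⊓ position (pathOf u v) v)

  -- part a b is j < k on the edges of cycle j and k on the edges of the square
  part : Vertex → Vertex → ℕ
  part (fin u) (fin v) = finPart u v
  part (fin u) (hub h) = hubPart h u
  part (hub h) (fin v) = hubPart h v
  part (hub _) (hub _) = k

  part-sym : ∀ a b → part a b ≡ part b a
  part-sym (fin u) (fin v) rewrite +-comm u v =
    cong (edgePart (pathOf v u)) (⊓-comm (position (pathOf v u) u) _)
  part-sym (fin u) (hub h) = refl
  part-sym (hub h) (fin v) = refl
  part-sym (hub h) (hub h′) = refl

  edgePart-top : ∀ t → edgePart k t ≡ k
  edgePart-top zero = refl
  edgePart-top (suc t) with suc t ≟ k + k
  ... | yes _ = refl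
  ... | no _ = refl

  edgePart-penultimate : ∀ j → edgePart j (k + k) ≡ k
  edgePart-penultimate j = at (k + k) refl
    where
    at : ∀ t → t ≡ k + k → edgePart j t ≡ k
    at zero _ = refl
    at (suc t) eq with suc t ≟ k + k
    ... | yes _ = refl
    ... | no ≢ = ⊥-elim (≢ eq)

  finPart-top : ∀ u v → pathOf u v ≡ k → finPart u v ≡ k
  finPart-top u v eq rewrite eq = edgePart-top (position k u ⊓ position k v)

  finPart-first : ∀ {j} → j ≤ k → finPart (path j 0) (path j 1) ≡ k
  finPart-first {j} j≤k
    rewrite pathOf-path 0 j≤k (s≤s (s≤s z≤n))
          | position-path 0 (≤k⇒≤n j≤k) z<s = refl

  finPart-last : ∀ {j} → j ≤ k → finPart (path j (k + k)) (path j last) ≡ k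
  finPart-last {j} j≤k
    rewrite pathOf-path (k + k) j≤k ≤-refl
          | position-path (k + k) (≤k⇒≤n j≤k) (≤-trans (n<1+n _) (n≤1+n _))
          | position-path last (≤k⇒≤n j≤k) ≤-refl
          | m≤n⇒m⊓n≡m (n≤1+n (k + k)) = edgePart-penultimate j

  finPart-interior : ∀ {j} t → j ≤ k → suc t < k + k → finPart (path j (suc t)) (path j (suc (suc t))) ≡ j
  finPart-interior {j} t j≤k t+1<k+k
    rewrite pathOf-path (suc t) j≤k (s≤s (s≤s (<⇒≤ t+1<k+k)))
          | position-path (suc t) (≤k⇒≤n j≤k) (≤-trans t+1<k+k (≤-trans (n≤1+n _) (n≤1+n _)))
          | position-path (suc (suc t)) (≤k⇒≤n j≤k) (s≤s (≤-trans t+1<k+k (n≤1+n _)))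
          | m≤n⇒m⊓n≡m (n≤1+n t) with suc t ≟ k + k
  ... | yes eq = ⊥-elim (<⇒≢ t+1<k+k eq)
  ... | no _ = refl

  -- the chords of the square are the first and the last edges of the other paths
  chord-first : ∀ {a j} → a + suc j ≡ k →
                path k (a + a) ≡ path j 1 × path k (suc (suc (a + a))) ≡ path j 0
  chord-first {a} {j} a+1+j≡k = (begin
      path k (a + a)   ≡⟨ path-even-low (subst (a ≤_) a+1+j≡k (m≤m+n a (suc j))) k<n ⟩
      k ∸ a            ≡⟨ cong (_∸ a) a+1+j≡k ⟨
      a + suc j ∸ a    ≡⟨ m+n∸m≡n a (suc j) ⟩
      suc j            ≡⟨ path-second (≤-<-trans (subst (suc j ≤_) a+1+j≡k (m≤n+m (suc j) a)) k<n) ⟨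
      path j 1         ∎)
    , (begin
      path k (suc (suc (a + a)))   ≡⟨ cong (path k ∘ suc) (+-suc a a) ⟨
      path k (suc a + suc a)       ≡⟨ path-even-low (subst (suc a ≤_) 1+a+j≡k (m≤m+n (suc a) j)) k<n ⟩
      k ∸ suc a                    ≡⟨ cong (_∸ suc a) 1+a+j≡k ⟨
      suc a + j ∸ suc a            ≡⟨ m+n∸m≡n (suc a) j ⟩
      j                            ≡⟨ path-start (<k⇒<n (subst (j <_) 1+a+j≡k (m<n+m j z<s))) ⟨
      path j 0                     ∎)
    where
    open ≡-Reasoning
    1+a+j≡k : suc a + j ≡ k
    1+a+j≡k = trans (sym (+-suc a j)) a+1+j≡k

  chord-last : ∀ {j} → j < k →
               path k (suc (j + j)) ≡ path j last × path k (suc (suc (suc (j + j)))) ≡ path j (k + k)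
  chord-last {j} j<k = (begin
      path k (suc (j + j))   ≡⟨ path-odd j (≤-<-trans (+-monoʳ-≤ k j<k) (n≤1+n _)) ⟩
      k + suc j              ≡⟨ +-suc k j ⟩
      suc k + j              ≡⟨ path-end (<⇒≤ j<k) ⟨
      path j last            ∎)
    , (begin
      path k (suc (suc (suc (j + j))))   ≡⟨ cong (λ x → path k (suc (suc x))) (+-suc j j) ⟨
      path k (suc (suc j + suc j))       ≡⟨ path-odd (suc j) (≤-<-trans (+-monoʳ-≤ k (s≤s j<k)) k+1+k<n) ⟩
      k + suc (suc j)                    ≡⟨ trans (+-suc k (suc j)) (cong suc (+-suc k j)) ⟩
      2 + k + j                          ≡⟨ path-penultimate j<k ⟨
      path j (k + k)                     ∎)
    where
    open ≡-Reasoning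
    k+1+k<n : k + suc k < n
    k+1+k<n = subst (_< n) (sym (+-suc k k)) ≤-refl

  square-next : ∀ p → suc p < m → part (square p) (square (suc p)) ≡ k
  square-next 0 _ = refl
  square-next 1 _ = refl
  square-next 2 _ rewrite path-start k<n =
    attachment-none 0 (2 + k) (inj₂ ≤-refl) (inj₁ (≤-trans (n<1+n k) (n≤1+n _)))
  square-next (suc (suc (suc t))) lt =
    finPart-top (path k t) (path k (suc t)) (pathOf-path t ≤-refl (s≤s⁻¹ (s≤s⁻¹ (s≤s⁻¹ lt))))

  square-skip : ∀ p → 2 + p < m → part (square p) (square (2 + p)) ≡ k
  square-skip 0 _ = refl
  square-skip 1 _ rewrite path-start k<n = attachment-none 0 (1 + k) (inj₂ ≤-refl) (inj₁ (n<1+n k))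
  square-skip 2 _ rewrite path-second (≤k⇒<n ≤-refl) =
    attachment-none 0 (2 + k) (inj₂ (n≤1+n k)) (inj₁ (n<1+n (suc k)))
  square-skip (suc (suc (suc t))) lt with half t
  ... | even a = begin
    finPart (path k (a + a)) (path k (suc (suc (a + a))))
      ≡⟨ cong₂ finPart (proj₁ chord) (proj₂ chord) ⟩
    finPart (path j 1) (path j 0)
      ≡⟨ part-sym (fin (path j 1)) (fin (path j 0)) ⟩
    finPart (path j 0) (path j 1)
      ≡⟨ finPart-first (m∸n≤m k (suc a)) ⟩
    k ∎
    where
    open ≡-Reasoning
    a<k : a < k
    a<k = even<n (subst (_< n) (cong suc (sym (+-suc a a))) (s≤s⁻¹ (s≤s⁻¹ (s≤s⁻¹ lt))))
    j = k ∸ suc a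
    chord = chord-first (trans (+-suc a j) (m+[n∸m]≡n a<k))
  ... | odd a = begin
    finPart (path k (suc (a + a))) (path k (suc (suc (suc (a + a)))))
      ≡⟨ cong₂ finPart (proj₁ chord) (proj₂ chord) ⟩
    finPart (path a last) (path a (k + k))
      ≡⟨ part-sym (fin (path a last)) (fin (path a (k + k))) ⟩
    finPart (path a (k + k)) (path a last)
      ≡⟨ finPart-last (<⇒≤ a<k) ⟩
    k ∎
    where
    open ≡-Reasoning
    a<k : a < k
    a<k = odd<n (subst (_< n) (cong (suc ∘ suc) (sym (+-suc a a))) (s≤s⁻¹ (s≤s⁻¹ (s≤s⁻¹ lt))))
    chord = chord-last a<k

  square-wrap : part (square (2 + n)) (square 0) ≡ k
  square-wrap rewrite path-end (≤-refl {k}) = attachment-none 1 (1 + k) (inj₂ (s≤s (m≤m+n k k))) (inj₂ ≤-refl)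

  square-wrap₀ : part (square (1 + n)) (square 0) ≡ k
  square-wrap₀ rewrite path-even-low (≤-refl {k}) k<n | n∸n≡0 k = attachment-none 1 (1 + k) (inj₁ z<s) (inj₁ z<s)

  square-wrap₁ : part (square (2 + n)) (square 1) ≡ k
  square-wrap₁ rewrite path-end (≤-refl {k}) = attachment-none 0 (1 + k) (inj₂ (m≤n+m k (suc k))) (inj₂ ≤-refl)

  cycle-next : ∀ {j} → j < k → ∀ p → suc p < m → part (cycle j p) (cycle j (suc p)) ≡ j
  cycle-next j<k 0 _ rewrite path-start (<k⇒<n j<k) = attachment-first 0 (2 + k) j<k
  cycle-next j<k 1 _ rewrite path-start (<k⇒<n j<k) = attachment-first 0 (1 + k) j<k
  cycle-next j<k 2 _ rewrite path-end (<⇒≤ j<k) = attachment-second 0 (1 + k) (n≤1+n k) j<k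
  cycle-next j<k 3 _ rewrite path-end (<⇒≤ j<k) = attachment-second 1 (1 + k) ≤-refl j<k
  cycle-next j<k 4 _ rewrite path-second (≤k⇒<n (<⇒≤ j<k)) = attachment-first 1 (1 + k) j<k
  cycle-next j<k (suc (suc (suc (suc (suc t))))) lt =
    finPart-interior t (<⇒≤ j<k) (s≤s⁻¹ (s≤s⁻¹ (s≤s⁻¹ (s≤s⁻¹ (s≤s⁻¹ lt)))))

  cycle-tail : ∀ j t → 0 < t → cycle j (4 + t) ≡ fin (path j t)
  cycle-tail j (suc t) _ = refl

  0<k+k : ∀ {j} → j < k → 0 < k + k
  0<k+k j<k = ≤-trans (≤-trans (s≤s z≤n) j<k) (m≤m+n k k)

  cycle-wrap : ∀ {j} → j < k → part (cycle j (2 + n)) (cycle j 0) ≡ j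
  cycle-wrap {j} j<k rewrite cycle-tail j (k + k) (0<k+k j<k) | path-penultimate j<k =
    attachment-second 0 (2 + k) (≤-trans (n≤1+n k) (n≤1+n _)) j<k

  Covered : Vertex → Vertex → Set
  Covered a b = (∃[ s ] s ∈ (1 ∷ 2 ∷ []) × (Joined m square s a b ⊎ Joined m square s b a))
              ⊎ (∃[ j ] j < k × (Joined m (cycle j) 1 a b ⊎ Joined m (cycle j) 1 b a))

  covered-sym : ∀ {a b} → Covered a b → Covered b a
  covered-sym (inj₁ (s , s∈ , e)) = inj₁ (s , s∈ , swap e)
  covered-sym (inj₂ (j , j<k , e)) = inj₂ (j , j<k , swap e)

  on-square₁ : ∀ {a b} → Joined m square 1 a b → Covered a b
  on-square₁ e = inj₁ (1 , here refl , inj₁ e)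

  on-square₂ : ∀ {a b} → Joined m square 2 a b → Covered a b
  on-square₂ e = inj₁ (2 , there (here refl) , inj₁ e)

  on-cycle : ∀ {j a b} → j < k → Joined m (cycle j) 1 a b → Covered a b
  on-cycle j<k e = inj₂ (_ , j<k , inj₁ e)

  covered-edge : ∀ j t {u v} → PathEdge j t u v → Covered (fin (path j t)) (fin (path j (suc t))) →
                 Covered (fin u) (fin v)
  covered-edge j t (inj₁ (p , q)) c = subst₂ Covered (cong fin p) (cong fin q) c
  covered-edge j t (inj₂ (p , q)) c = covered-sym (subst₂ Covered (cong fin p) (cong fin q) c)

  first-edge-covered : ∀ {j} → j < k → Covered (fin (path j 0)) (fin (path j 1))
  first-edge-covered {j} j<k =
    covered-sym (on-square₂ (subst₂ (Joined m square 2) (cong fin (proj₁ chord)) (cong fin (proj₂ chord))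
                                    (joined-skip (3 + (a + a)) (+-monoʳ-< 5 (+-mono-< a<k a<k)))))
    where
    a = k ∸ suc j
    a<k : a < k
    a<k = ∸-monoʳ-< z<s j<k
    chord = chord-first (m∸n+n≡m j<k)

  last-edge-covered : ∀ {j} → j < k → Covered (fin (path j (k + k))) (fin (path j last))
  last-edge-covered {j} j<k =
    covered-sym (on-square₂ (subst₂ (Joined m square 2) (cong fin (proj₁ chord)) (cong fin (proj₂ chord))
                                    (joined-skip (3 + suc (j + j)) (+-monoʳ-< 5 j+j+1<k+k))))
    where
    chord = chord-last j<k
    j+j+1<k+k : suc (j + j) < k + k
    j+j+1<k+k = subst (_≤ k + k) (cong suc (+-suc j j)) (+-mono-≤ j<k j<k)

  covered-fin : ∀ u v → u < n → v < n → u ≢ v → Covered (fin u) (fin v)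
  covered-fin u v u<n v<n u≢v with pathOf-edge u v u<n v<n u≢v
  ... | t , t+1<n , edge = covered-edge j t edge (on-edge (m≤n⇒m<n∨m≡n (pathOf≤k u v)) t t+1<n)
    where
    j = pathOf u v
    on-edge : j < k ⊎ j ≡ k → ∀ t → suc t < n → Covered (fin (path j t)) (fin (path j (suc t)))
    on-edge (inj₂ j≡k) t t+1<n = subst (λ i → Covered (fin (path i t)) (fin (path i (suc t)))) (sym j≡k)
                                       (on-square₁ (joined-next (3 + t) (s≤s (s≤s (s≤s t+1<n)))))
    on-edge (inj₁ j<k) zero _ = first-edge-covered j<k
    on-edge (inj₁ j<k) (suc t) t+1<n with suc t ≟ k + k
    ... | yes t+1≡k+k = subst (λ w → Covered (fin (path j w)) (fin (path j (suc w)))) (sym t+1≡k+k)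
                              (last-edge-covered j<k)
    ... | no t+1≢k+k =
            on-cycle j<k (joined-next (4 + suc t) (+-monoʳ-< 5 (≤∧≢⇒< (s≤s⁻¹ (s≤s⁻¹ t+1<n)) t+1≢k+k)))

  locate : ∀ c u → u < c ⊎ (∃[ j ] j < k × c + j ≡ u) ⊎ c + k ≤ u
  locate c u with u <? c
  ... | yes u<c = inj₁ u<c
  ... | no u≮c with u ∸ c <? k
  ...   | yes lt = inj₂ (inj₁ (u ∸ c , lt , m+[n∸m]≡n (≮⇒≥ u≮c)))
  ...   | no ≮k = inj₂ (inj₂ (subst (c + k ≤_) (m+[n∸m]≡n (≮⇒≥ u≮c)) (+-monoʳ-≤ c (≮⇒≥ ≮k))))

  pin : ∀ {a u} → a ≤ u → u < suc a → u ≡ a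
  pin a≤u u<1+a = ≤-antisym (s≤s⁻¹ u<1+a) a≤u

  relabel : ∀ {a v w} → v ≡ w → Covered a (fin v) → Covered a (fin w)
  relabel v≡w = subst (λ x → Covered _ (fin x)) v≡w

  covered-∞ : ∀ u → u < n → Covered (hub ∞) (fin u)
  covered-∞ u u<n with locate 0 u
  ... | inj₂ (inj₁ (j , j<k , refl)) =
        relabel (path-start (<k⇒<n j<k)) (covered-sym (on-cycle j<k (joined-next 1 (s≤s (m≤m+n 2 _)))))
  ... | inj₂ (inj₂ k≤u) with locate (suc k) u
  ...   | inj₁ u<1+k =
          relabel (trans (path-start k<n) (sym (pin k≤u u<1+k))) (on-square₂ (joined-skip 1 (s≤s (m≤m+n 3 _))))
  ...   | inj₂ (inj₁ (j , j<k , refl)) =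
          relabel (path-end (<⇒≤ j<k)) (on-cycle j<k (joined-next 2 (s≤s (m≤m+n 3 _))))
  ...   | inj₂ (inj₂ last≤u) =
          relabel (trans (path-end ≤-refl) (sym (pin last≤u u<n))) (covered-sym (on-square₂ (joined-wrap₁ (1 + n))))

  covered-X : ∀ u → u < n → Covered (hub X) (fin u)
  covered-X u u<n with locate 0 u
  ... | inj₂ (inj₁ (j , j<k , refl)) =
        relabel (path-start (<k⇒<n j<k)) (on-cycle j<k (joined-next 0 (s≤s (m≤m+n 1 _))))
  ... | inj₂ (inj₂ k≤u) with locate (2 + k) u
  ...   | inj₂ (inj₂ 2+k+k≤u) = ⊥-elim (<⇒≱ u<n 2+k+k≤u)
  ...   | inj₂ (inj₁ (j , j<k , refl)) =
          relabel (path-penultimate j<k)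
            (subst (λ a → Covered (hub X) a) (cycle-tail j (k + k) (0<k+k j<k))
              (covered-sym (on-cycle j<k (joined-wrap (2 + n)))))
  ...   | inj₁ u<2+k with m≤n⇒m<n∨m≡n k≤u
  ...     | inj₂ refl = relabel (path-start k<n) (on-square₁ (joined-next 2 (s≤s (m≤m+n 3 _))))
  ...     | inj₁ k<u =
            relabel (trans (path-second (≤k⇒<n ≤-refl)) (sym (pin k<u u<2+k)))
              (on-square₂ (joined-skip 2 (s≤s (m≤m+n 4 _))))

  covered-Y : ∀ u → u < n → Covered (hub Y) (fin u)
  covered-Y u u<n with locate 1 u
  ... | inj₁ (s≤s z≤n) =
        relabel (trans (path-even-low ≤-refl k<n) (n∸n≡0 k)) (covered-sym (on-square₂ (joined-wrap₀ (1 + n))))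
  ... | inj₂ (inj₁ (j , j<k , refl)) =
        relabel (path-second (≤k⇒<n (<⇒≤ j<k))) (on-cycle j<k (joined-next 4 (+-monoʳ-< 5 (0<k+k j<k))))
  ... | inj₂ (inj₂ 1+k≤u) with locate (1 + k) u
  ...   | inj₁ u<1+k = ⊥-elim (<⇒≱ u<1+k 1+k≤u)
  ...   | inj₂ (inj₁ (j , j<k , refl)) =
          relabel (path-end (<⇒≤ j<k)) (covered-sym (on-cycle j<k (joined-next 3 (s≤s (m≤m+n 4 _)))))
  ...   | inj₂ (inj₂ last≤u) =
          relabel (trans (path-end ≤-refl) (sym (pin last≤u u<n))) (covered-sym (on-square₁ (joined-wrap (2 + n))))

  covered-hub : ∀ h u → u < n → Covered (hub h) (fin u)
  covered-hub ∞ = covered-∞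
  covered-hub X = covered-X
  covered-hub Y = covered-Y

  covered-hubs : ∀ h h′ → h ≢ h′ → Covered (hub h) (hub h′)
  covered-hubs ∞ ∞ h≢h′ = ⊥-elim (h≢h′ refl)
  covered-hubs X X h≢h′ = ⊥-elim (h≢h′ refl)
  covered-hubs Y Y h≢h′ = ⊥-elim (h≢h′ refl)
  covered-hubs Y ∞ _ = on-square₁ (joined-next 0 (s≤s (m≤m+n 1 _)))
  covered-hubs ∞ X _ = on-square₁ (joined-next 1 (s≤s (m≤m+n 2 _)))
  covered-hubs Y X _ = on-square₂ (joined-skip 0 (s≤s (m≤m+n 2 _)))
  covered-hubs ∞ Y _ = covered-sym (covered-hubs Y ∞ λ ())
  covered-hubs X ∞ _ = covered-sym (covered-hubs ∞ X λ ())
  covered-hubs X Y _ = covered-sym (covered-hubs Y X λ ())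

  covered : ∀ a b → encode a < m → encode b < m → a ≢ b → Covered a b
  covered (fin u) (fin v) a<m b<m a≢b =
    covered-fin u v (s≤s⁻¹ (s≤s⁻¹ (s≤s⁻¹ a<m))) (s≤s⁻¹ (s≤s⁻¹ (s≤s⁻¹ b<m))) (a≢b ∘ cong fin)
  covered (fin u) (hub h) a<m _ _ = covered-sym (covered-hub h u (s≤s⁻¹ (s≤s⁻¹ (s≤s⁻¹ a<m))))
  covered (hub h) (fin v) _ b<m _ = covered-hub h v (s≤s⁻¹ (s≤s⁻¹ (s≤s⁻¹ b<m)))
  covered (hub h) (hub h′) _ _ a≢b = covered-hubs h h′ (a≢b ∘ cong hub)

  hub<m : ∀ h → encode (hub h) < m
  hub<m Y = z<s
  hub<m ∞ = s<s z<s
  hub<m X = s<s (s<s z<s)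

  square<m : ∀ p → encode (square p) < m
  square<m 0 = hub<m Y
  square<m 1 = hub<m ∞
  square<m 2 = hub<m X
  square<m (suc (suc (suc t))) = s≤s (s≤s (s≤s (path<n k t)))

  cycle<m : ∀ j p → encode (cycle j p) < m
  cycle<m j 0 = hub<m X
  cycle<m j 1 = s≤s (s≤s (s≤s (path<n j 0)))
  cycle<m j 2 = hub<m ∞
  cycle<m j 3 = s≤s (s≤s (s≤s (path<n j last)))
  cycle<m j 4 = hub<m Y
  cycle<m j (suc (suc (suc (suc (suc t))))) = s≤s (s≤s (s≤s (path<n j (suc t))))

  squareSlot : Vertex → ℕ
  squareSlot (hub Y) = 0
  squareSlot (hub ∞) = 1
  squareSlot (hub X) = 2
  squareSlot (fin v) = 3 + position k v

  squareSlot-square : ∀ p → p < m → squareSlot (square p) ≡ p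
  squareSlot-square 0 _ = refl
  squareSlot-square 1 _ = refl
  squareSlot-square 2 _ = refl
  squareSlot-square (suc (suc (suc t))) p<m =
    cong (3 +_) (position-path t (≤k⇒≤n ≤-refl) (s≤s⁻¹ (s≤s⁻¹ (s≤s⁻¹ p<m))))

  pathSlot : ℕ → ℕ
  pathSlot zero = 1
  pathSlot (suc t) with suc t ≟ last
  ... | yes _ = 3
  ... | no _ = 5 + t

  cycleSlot : ℕ → Vertex → ℕ
  cycleSlot j (hub X) = 0
  cycleSlot j (hub ∞) = 2
  cycleSlot j (hub Y) = 4
  cycleSlot j (fin v) = pathSlot (position j v)

  cycleSlot-cycle : ∀ {j} → j < k → ∀ p → p < m → cycleSlot j (cycle j p) ≡ p
  cycleSlot-cycle j<k 0 _ = refl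
  cycleSlot-cycle j<k 1 _ rewrite position-path 0 (≤k⇒≤n (<⇒≤ j<k)) z<s = refl
  cycleSlot-cycle j<k 2 _ = refl
  cycleSlot-cycle j<k 3 _ rewrite position-path last (≤k⇒≤n (<⇒≤ j<k)) ≤-refl with last ≟ last
  ... | yes _ = refl
  ... | no ≢ = ⊥-elim (≢ refl)
  cycleSlot-cycle j<k 4 _ = refl
  cycleSlot-cycle {j} j<k (suc (suc (suc (suc (suc t))))) p<m =
    interior (s≤s⁻¹ (s≤s⁻¹ (s≤s⁻¹ (s≤s⁻¹ p<m))))
    where
    interior : suc t < last → pathSlot (position j (path j (suc t))) ≡ 5 + t
    interior t+1<last
      rewrite position-path (suc t) (≤k⇒≤n (<⇒≤ j<k)) (<-trans t+1<last ≤-refl) with suc t ≟ last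
    ... | yes eq = ⊥-elim (<⇒≢ t+1<last eq)
    ... | no _ = refl

  ψ : Fin m → Fin m
  ψ = Lift.lift encode square square<m

  cyc : Fin k → Fin m → Fin m
  cyc i = Lift.lift encode (cycle (toℕ i)) (cycle<m (toℕ i))

  ψ-injective : Injective _≡_ _≡_ ψ
  ψ-injective = Lift.lift-injective encode square square<m (squareSlot ∘ decode)
    λ p p<m → trans (cong squareSlot (decode-encode (square p))) (squareSlot-square p p<m)

  cyc-injective : ∀ i → Injective _≡_ _≡_ (cyc i)
  cyc-injective i = Lift.lift-injective encode (cycle j) (cycle<m j) (cycleSlot j ∘ decode)
    λ p p<m → trans (cong (cycleSlot j) (decode-encode (cycle j p))) (cycleSlot-cycle (toℕ<n i) p p<m)
    where j = toℕ i

  classify : Fin m → Fin m → ℕ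
  classify u v = part (decode (toℕ u)) (decode (toℕ v))

  label : Fin (suc k) → ℕ
  label Fin.zero = k
  label (Fin.suc i) = toℕ i

  label-injective : Injective _≡_ _≡_ label
  label-injective {Fin.zero} {Fin.zero} _ = refl
  label-injective {Fin.zero} {Fin.suc j} eq = ⊥-elim (<⇒≢ (toℕ<n j) (sym eq))
  label-injective {Fin.suc i} {Fin.zero} eq = ⊥-elim (<⇒≢ (toℕ<n i) eq)
  label-injective {Fin.suc i} {Fin.suc j} eq = cong Fin.suc (toℕ-injective eq)

  classify-image : ∀ {ℓ u v} → (∃₂ λ a b → part a b ≡ ℓ × encode a ≡ toℕ u × encode b ≡ toℕ v) →
                   classify u v ≡ ℓ
  classify-image (a , b , part≡ , a↦u , b↦v)
    rewrite sym a↦u | sym b↦v | decode-encode a | decode-encode b = part≡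

  parts-sound : ∀ i u v → Parts m k cyc ψ i u v → classify u v ≡ label i
  parts-sound Fin.zero u v h =
    classify-image (Lift.image-sound encode square square<m R (λ {a} {b} → trans (part-sym b a)) steps u v h)
    where
    R = λ a b → part a b ≡ k
    steps : ∀ {s} → s ∈ (1 ∷ 2 ∷ []) → ∀ p q → p < m → q < m → Step m p s q → R (square p) (square q)
    steps (here refl) = Around.steps₁ R square square-next square-wrap
    steps (there (here refl)) = Around.steps₂ R square square-skip square-wrap₀ square-wrap₁
  parts-sound (Fin.suc i) u v h =
    classify-image
      (Lift.image-sound encode (cycle j) (cycle<m j) R (λ {a} {b} → trans (part-sym b a)) steps u v h)
    where
    j = toℕ i
    R = λ a b → part a b ≡ j
    steps : ∀ {s} → s ∈ (1 ∷ []) → ∀ p q → p < m → q < m → Step m p s q → R (cycle j p) (cycle j q)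
    steps (here refl) = Around.steps₁ R (cycle j) (cycle-next (toℕ<n i)) (cycle-wrap (toℕ<n i))

  parts-cover : ∀ u v → u ≢ v → ∃[ i ] Parts m k cyc ψ i u v
  parts-cover u v u≢v
    with covered (decode (toℕ u)) (decode (toℕ v)) (bound u) (bound v) (u≢v ∘ decode-injective)
    where
    bound : ∀ w → encode (decode (toℕ w)) < m
    bound w = subst (_< m) (sym (encode-decode (toℕ w))) (toℕ<n w)
    decode-injective : decode (toℕ u) ≡ decode (toℕ v) → u ≡ v
    decode-injective eq =
      toℕ-injective (trans (sym (encode-decode (toℕ u))) (trans (cong encode eq) (encode-decode (toℕ v))))
  ... | inj₁ (s , s∈ , e) =
    Fin.zero , Lift.image-joined encode square square<m s∈ (encode-decode (toℕ u)) (encode-decode (toℕ v)) e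
  ... | inj₂ (j , j<k , e) =
    Fin.suc (fromℕ< j<k) , Lift.image-joined encode (cycle (toℕ (fromℕ< j<k))) (cycle<m _) (here refl)
      (encode-decode (toℕ u)) (encode-decode (toℕ v))
      (subst (λ i → Joined m (cycle i) 1 _ _ ⊎ Joined m (cycle i) 1 _ _) (sym (toℕ-fromℕ< j<k)) e)

  parts-loopless : ∀ i u v → Parts m k cyc ψ i u v → ¬ u ≡ v
  parts-loopless Fin.zero = image-loopless ψ ψ-injective (circ-loopless (1 ∷ 2 ∷ []) steps)
    where
    steps : ∀ {s} → s ∈ (1 ∷ 2 ∷ []) → 0 < s × s < m
    steps (here refl) = z<s , s<s z<s
    steps (there (here refl)) = z<s , s<s (s<s z<s)
  parts-loopless (Fin.suc i) =
    image-loopless (cyc i) (cyc-injective i) (circ-loopless (1 ∷ []) λ { (here refl) → z<s , s<s z<s })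

  cycles-and-square : CyclesAndSquare m k
  cycles-and-square = cyc , ψ , cyc-injective , ψ-injective ,
    decomposition-by-classifier (Parts m k cyc ψ) classify label label-injective
      parts-loopless parts-sound parts-cover

a+a≡a*2 : ∀ a → a + a ≡ a * 2
a+a≡a*2 a = trans (cong (a +_) (sym (+-identityʳ a))) (*-comm 2 a)

[a+a]%2≡0 : ∀ a → (a + a) % 2 ≡ 0
[a+a]%2≡0 a = trans (cong (_% 2) (a+a≡a*2 a)) (m*n%n≡0 a 2)

odd≥5⇒≡5+k+k : ∀ m → 5 ≤ m → m % 2 ≡ 1 → ∃[ k ] m ≡ 5 + (k + k)
odd≥5⇒≡5+k+k m 5≤m m-odd with half m
... | even a = ⊥-elim (0≢1+n (trans (sym ([a+a]%2≡0 a)) m-odd))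
... | odd zero = ⊥-elim (<⇒≱ (s≤s (s≤s z≤n)) 5≤m)
... | odd (suc zero) = ⊥-elim (<⇒≱ (s≤s (s≤s (s≤s (s≤s z≤n)))) 5≤m)
... | odd (suc (suc k)) = k , cong (3 +_) (trans (+-suc k (suc k)) (cong suc (+-suc k k)))

lemma5 : (m : ℕ) → 7 ≤ m → m % 2 ≡ 1 →
    Σ (Fin ((m ∸ 5) / 2) → Fin m → Fin m) λ cyc →
    Σ (Fin m → Fin m) λ ψ →
    (∀ i → Injective _≡_ _≡_ (cyc i)) ×
    Injective _≡_ _≡_ ψ ×
    IsDecompositionOfK m (suc ((m ∸ 5) / 2)) (Parts m ((m ∸ 5) / 2) cyc ψ)
lemma5 m 7≤m m-odd with odd≥5⇒≡5+k+k m (≤-trans (m≤m+n 5 2) 7≤m) m-odd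
... | k , refl = subst (CyclesAndSquare (5 + (k + k))) (sym k+k/2≡k) (Construction.cycles-and-square k)
  where
  k+k/2≡k : (k + k) / 2 ≡ k
  k+k/2≡k = trans (cong (_/ 2) (a+a≡a*2 k)) (m*n/n≡m k 2)
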